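{- Let $q\ge2$ be a prime power, let $n\ge5$, and let $x$ be the unique positive real solution of $\log_q(x+1)=x-\binom{n}{\lfloor n/2\rfloor}$. Then $\operatorname{Trank}(\det^n_{\mathbb{F}_q})\ge\lceil x\rceil$. In particular, $\operatorname{Trank}(\det^n_{\mathbb{F}_q})\ge\binom{n}{\lfloor n/2\rfloor}+\log_q\binom{n}{\lfloor n/2\rfloor}$.
   Context: $\mathbb{F}_q$ is the field with $q$ elements. $\det^n_{\mathbb{F}_q}=\sum_{\sigma\in S_n}\operatorname{sgn}(\sigma)\mathbf{e}_{\sigma(1)}\otimes\cdots\otimes\mathbf{e}_{\sigma(n)}\in(\mathbb{F}_q^n)^{\otimes n}$, and $\operatorname{Trank}$ is tensor rank (least number of elementary tensors $\mathbf{v_1}\otimes\cdots\otimes\mathbf{v_n}$ summing to the tensor). -}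

module Defs where

open import Level using (Level; _⊔_)
open import Data.Nat as ℕ using (ℕ; zero; suc; _^_; _∸_; _<_; _≤_)
open import Data.Nat.Primality using (Prime)
open import Data.Nat.Combinatorics using (_C_)
open import Data.Nat.DivMod using (_/_)
open import Data.Fin as Fin using (Fin; _≟_; _<?_)
open import Data.Product using (Σ; ∃; _×_; _,_)
open import Relation.Nullary using (¬_; yes; no)
open import Relation.Binary.PropositionalEquality using (_≡_)
open import Algebra.Bundles using (CommutativeRing)

record Field c ℓ : Set (Level.suc (c ⊔ ℓ)) where
  field
    commutativeRing : CommutativeRing c ℓ
  open CommutativeRing commutativeRing public
  field
    0≉1     : ¬ (0# ≈ 1#)
    inverse : ∀ x → ¬ (x ≈ 0#) → ∃ λ y → (x * y) ≈ 1#

HasCardinality : ∀ {c ℓ} → Field c ℓ → ℕ → Set (c ⊔ ℓ)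
HasCardinality F q = Σ (Fin q → Carrier) λ f →
    (∀ i j → f i ≈ f j → i ≡ j) × (∀ x → ∃ λ i → f i ≈ x)
  where open Field F

IsPrimePower : ℕ → Set
IsPrimePower q = ∃ λ p → ∃ λ k → Prime p × q ≡ p ^ suc k

centralBinom : ℕ → ℕ
centralBinom n = n C (n / 2)

module TensorDefs {c ℓ} (F : Field c ℓ) where
  open Field F

  Σᶠ : ∀ {m} → (Fin m → Carrier) → Carrier
  Σᶠ {zero}  f = 0#
  Σᶠ {suc m} f = f Fin.zero + Σᶠ (λ i → f (Fin.suc i))

  Πᶠ : ∀ {m} → (Fin m → Carrier) → Carrier
  Πᶠ {zero}  f = 1#
  Πᶠ {suc m} f = f Fin.zero * Πᶠ (λ i → f (Fin.suc i))

  -- Vectors in F^n and tensors in (F^n)^{⊗n}, the latter given by their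
  -- coordinates w.r.t. the basis e_{i(1)} ⊗ ⋯ ⊗ e_{i(n)}, i : Fin n → Fin n.
  Vecᶠ : ℕ → Set c
  Vecᶠ n = Fin n → Carrier

  Tensor : ℕ → Set c
  Tensor n = (Fin n → Fin n) → Carrier

  _≈ᵀ_ : ∀ {n} → Tensor n → Tensor n → Set ℓ
  S ≈ᵀ T = ∀ i → S i ≈ T i

  elementary : ∀ {n} → (Fin n → Vecᶠ n) → Tensor n
  elementary v i = Πᶠ (λ k → v k (i k))

  sumT : ∀ {n r} → (Fin r → Tensor n) → Tensor n
  sumT T i = Σᶠ (λ j → T j i)

  ε : ∀ {n} → Fin n → Fin n → Carrier
  ε a b with a ≟ b
  ... | yes _ = 0#
  ... | no _ with a <? b
  ...   | yes _ = 1#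
  ...   | no _  = - 1#

  -- Levi-Civita symbol: sgn(i) if i is a permutation, 0 otherwise
  -- (product over pairs a < b of ε(i a, i b)).
  levi : ∀ {n} → (Fin n → Fin n) → Carrier
  levi {n} i = Πᶠ {n} λ a → Πᶠ {n} λ b → pairFactor a b
    where
    pairFactor : Fin n → Fin n → Carrier
    pairFactor a b with a <? b
    ... | yes _ = ε (i a) (i b)
    ... | no _  = 1#

  -- det^n = Σ_σ sgn(σ) e_{σ(1)} ⊗ ⋯ ⊗ e_{σ(n)}, in coordinates
  det : (n : ℕ) → Tensor n
  det n = levi

  HasRankDecomp : ∀ {n} → Tensor n → ℕ → Set (c ⊔ ℓ)
  HasRankDecomp {n} T r =
    Σ (Fin r → Fin n → Vecᶠ n) λ v → sumT (λ j → elementary (v j)) ≈ᵀ T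

{-# OPTIONS --safe #-}
-- Put k = ⌊n/2⌋ and l = n − k ≥ 3, and read det = Σ_{j<r} v_j(1) ⊗ ⋯ ⊗ v_j(n) as a tensor in
-- (Fⁿ)^{⊗k} ⊗ (Fⁿ)^{⊗l}. Each of the C = binom(n,k) splittings s of {1,…,n} into a k-set and an
-- l-set gives an index I_s of the first k factors, and for u ∈ F^C the tensor
--   T u = Σ_s u_s det(I_s, ·) = Σ_j (L u)_j v_j(k+1) ⊗ ⋯ ⊗ v_j(n),
-- where (L u)_j = Σ_s u_s v_j(1)(I_s 1) ⋯ v_j(k)(I_s k). If u_s ≠ 0 then, on the indices that put the
-- complement of I_s on the last l factors up to a permutation of three of them, T u is u_s times a
-- 3×3×3 tensor with the support of det₃, so T u is not a sum of two elementary tensors. Hence the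
-- r + 1 translates e_j + L(F^C) (e_0 = 0 and e_1, …, e_r the unit vectors of F^r) are pairwise
-- disjoint: a common point gives L(u − u′) = e_j′ − e_j, and then T(u − u′) has rank ≤ 2.
-- Counting, (r + 1) q^C ≤ q^r, so C ≤ r and r + 1 ≤ q^(r − C).
module Submission where

open import Defs
open import Data.Nat using (ℕ; zero; suc; _≤_; _^_; _∸_)
import Data.Nat as ℕ
import Data.Nat.Properties as ℕ
open import Data.Nat.DivMod using (_/_)
open import Data.Nat.Combinatorics using (_C_)
open import Data.Fin using (Fin; zero; suc; splitAt; _↑ˡ_; _↑ʳ_)
import Data.Fin.Properties as Fin
open import Data.Fin.Patterns using (0F; 1F; 2F)
open import Data.Sum using (_⊎_; inj₁; inj₂; [_,_]′)
import Data.Sum as Sum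
open import Data.Product using (_×_; _,_; proj₁; proj₂; ∃; ∃₂)
open import Function using (_∘_)
open import Relation.Nullary using (¬_; Dec; yes; no; contradiction)
open import Relation.Binary.PropositionalEquality as ≡ using (_≡_; _≢_; _≗_; cong; cong₂)

module Arithmetic where

  open import Data.Nat using (_+_; _*_; _≤?_)
  open import Data.Nat.DivMod using (m/n*n≤m)
  open import Data.Nat.Combinatorics using (nCn≡1; nCk+nC[k+1]≡[n+1]C[k+1])

  ⌊n/2⌋+3≤n : ∀ n → 5 ≤ n → n / 2 + 3 ≤ n
  ⌊n/2⌋+3≤n n 5≤n with 3 ≤? n / 2
  ... | yes 3≤n/2 = begin
    n / 2 + 3     ≤⟨ ℕ.+-monoʳ-≤ (n / 2) 3≤n/2 ⟩
    n / 2 + n / 2 ≡⟨ cong (n / 2 +_) (ℕ.+-identityʳ (n / 2)) ⟨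
    2 * (n / 2)   ≡⟨ ℕ.*-comm 2 (n / 2) ⟩
    n / 2 * 2     ≤⟨ m/n*n≤m n 2 ⟩
    n             ∎
    where open ℕ.≤-Reasoning
  ... | no 3≰n/2 = ℕ.≤-trans (ℕ.+-monoˡ-≤ 3 (ℕ.≤-pred (ℕ.≰⇒> 3≰n/2))) 5≤n

  exponent-gap : ∀ {q r c} → 2 ≤ q → suc r * q ^ c ≤ q ^ r → c ≤ r × suc r ≤ q ^ (r ∸ c)
  exponent-gap {q@(suc _)} {r} {c} 2≤q bound with c ≤? r
  ... | no c≰r = contradiction bound (ℕ.<⇒≱ (begin-strict
    q ^ r         <⟨ ℕ.^-monoʳ-< q 2≤q (ℕ.≰⇒> c≰r) ⟩
    q ^ c         ≤⟨ ℕ.m≤n*m (q ^ c) (suc r) ⟩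
    suc r * q ^ c ∎))
    where open ℕ.≤-Reasoning
  ... | yes c≤r = c≤r , ℕ.*-cancelʳ-≤ (suc r) (q ^ (r ∸ c)) (q ^ c) {{ℕ.m^n≢0 q c}} (begin
    suc r * q ^ c       ≤⟨ bound ⟩
    q ^ r               ≡⟨ cong (q ^_) (ℕ.m+[n∸m]≡n c≤r) ⟨
    q ^ (c + (r ∸ c))   ≡⟨ ℕ.^-distribˡ-+-* q c (r ∸ c) ⟩
    q ^ c * q ^ (r ∸ c) ≡⟨ ℕ.*-comm (q ^ c) (q ^ (r ∸ c)) ⟩
    q ^ (r ∸ c) * q ^ c ∎)
    where open ℕ.≤-Reasoning

  pascal : ℕ → ℕ → ℕ
  pascal zero    zero    = 1
  pascal zero    (suc l) = pascal zero l
  pascal (suc k) zero    = pascal k zero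
  pascal (suc k) (suc l) = pascal k (suc l) + pascal (suc k) l

  pascal≡C : ∀ k l → pascal k l ≡ (k + l) C k
  pascal≡C zero    zero    = ≡.refl
  pascal≡C zero    (suc l) = pascal≡C zero l
  pascal≡C (suc k) zero    = begin
    pascal k zero       ≡⟨ pascal≡C k zero ⟩
    (k + 0) C k         ≡⟨ cong (_C k) (ℕ.+-identityʳ k) ⟩
    k C k               ≡⟨ nCn≡1 k ⟩
    1                   ≡⟨ nCn≡1 (suc k) ⟨
    suc k C suc k       ≡⟨ cong (_C suc k) (ℕ.+-identityʳ (suc k)) ⟨
    (suc k + 0) C suc k ∎
    where open ≡.≡-Reasoning
  pascal≡C (suc k) (suc l) = begin
    pascal k (suc l) + pascal (suc k) l   ≡⟨ cong₂ _+_ (pascal≡C k (suc l)) (pascal≡C (suc k) l) ⟩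
    (k + suc l) C k + suc (k + l) C suc k ≡⟨ cong (λ n → (k + suc l) C k + n C suc k) (ℕ.+-suc k l) ⟨
    (k + suc l) C k + (k + suc l) C suc k ≡⟨ nCk+nC[k+1]≡[n+1]C[k+1] (k + suc l) k ⟩
    suc (k + suc l) C suc k               ∎
    where open ≡.≡-Reasoning

module Combinatorics where

  open import Data.Nat using (_+_; _*_)
  open import Data.Fin using (join; remQuot; combine; funToFin; finToFun)
  open import Data.Sum.Properties using (inj₁-injective; inj₂-injective; swap-↔)
  open import Function using (_↔_; mk↔ₛ′; Inverse)
  open import Function.Properties.Inverse using (↔-trans)
  open Arithmetic using (pascal)

  splitAt-injective : ∀ m {n} {i j : Fin (m + n)} → splitAt m i ≡ splitAt m j → i ≡ j
  splitAt-injective m {n} {i} {j} eq =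
    ≡.trans (≡.sym (Fin.join-splitAt m n i)) (≡.trans (cong (join m n) eq) (Fin.join-splitAt m n j))

  splitAt-≢ : ∀ {m n} {i j : Fin (m + n)} {x y} →
              splitAt m i ≡ x → splitAt m j ≡ y → i ≢ j → x ≢ y
  splitAt-≢ {m} e e′ i≢j x≡y = i≢j (splitAt-injective m (≡.trans e (≡.trans x≡y (≡.sym e′))))

  ↑ˡ≢↑ʳ : ∀ {k l} (a : Fin k) (b : Fin l) → a ↑ˡ l ≢ k ↑ʳ b
  ↑ˡ≢↑ʳ {k} {l} a b eq
    with ≡.trans (≡.sym (Fin.splitAt-↑ˡ k a l))
                 (≡.trans (cong (splitAt k) eq) (Fin.splitAt-↑ʳ k l b))
  ... | ()

  map₂-injective : ∀ {A B : Set} {ρ : B → B} → (∀ {b b′} → ρ b ≡ ρ b′ → b ≡ b′) →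
                   ∀ {x y : A ⊎ B} → Sum.map₂ ρ x ≡ Sum.map₂ ρ y → x ≡ y
  map₂-injective _     {inj₁ _} {inj₁ _} ≡.refl = ≡.refl
  map₂-injective ρ-inj {inj₂ _} {inj₂ _} eq     = cong inj₂ (ρ-inj (inj₂-injective eq))

  permuteˡ : ∀ {t m} → (Fin t → Fin t) → Fin (t + m) → Fin (t + m)
  permuteˡ {t} {m} π = join t m ∘ Sum.map₁ π ∘ splitAt t

  permuteˡ-↑ˡ : ∀ {t m} (π : Fin t → Fin t) a → permuteˡ {t} {m} π (a ↑ˡ m) ≡ π a ↑ˡ m
  permuteˡ-↑ˡ {t} {m} π a = cong (join t m ∘ Sum.map₁ π) (Fin.splitAt-↑ˡ t a m)

  permuteˡ-inverse : ∀ {t m} (π π′ : Fin t → Fin t) → (∀ a → π (π′ a) ≡ a) →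
                     ∀ p → permuteˡ {t} {m} π (permuteˡ π′ p) ≡ p
  permuteˡ-inverse {t} {m} π π′ π∘π′≗id p = begin
    join t m (Sum.map₁ π (splitAt t (join t m (Sum.map₁ π′ (splitAt t p)))))
      ≡⟨ cong (join t m ∘ Sum.map₁ π) (Fin.splitAt-join t m (Sum.map₁ π′ (splitAt t p))) ⟩
    join t m (Sum.map₁ π (Sum.map₁ π′ (splitAt t p)))
      ≡⟨ cong (join t m) (map₁-inverse (splitAt t p)) ⟩
    join t m (splitAt t p)
      ≡⟨ Fin.join-splitAt t m p ⟩
    p ∎
    where
    open ≡.≡-Reasoning
    map₁-inverse : ∀ x → Sum.map₁ π (Sum.map₁ π′ x) ≡ x
    map₁-inverse (inj₁ a) = cong inj₁ (π∘π′≗id a)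
    map₁-inverse (inj₂ _) = ≡.refl

  pigeonhole-⊎ : ∀ {k} {B : Set} (f : Fin (suc k) → Fin k ⊎ B) →
                 (∀ {a a′} → f a ≡ f a′ → a ≡ a′) → ∃₂ λ a b → f a ≡ inj₂ b
  pigeonhole-⊎ {k} {B} f f-injective with Fin.any? (λ a → inj₂? (f a))
    where
    inj₂? : (x : Fin k ⊎ B) → Dec (∃ λ b → x ≡ inj₂ b)
    inj₂? (inj₁ _) = no λ ()
    inj₂? (inj₂ b) = yes (b , ≡.refl)
  ... | yes found = found
  ... | no none = contradiction (Fin.injective⇒≤ lower-injective) ℕ.1+n≰n
    where
    lower : ∀ a x → f a ≡ x → Fin k
    lower a (inj₁ i) _  = i
    lower a (inj₂ b) fa = contradiction (a , b , fa) none

    lower-correct : ∀ a x (fa : f a ≡ x) → inj₁ (lower a x fa) ≡ f a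
    lower-correct a (inj₁ i) fa = ≡.sym fa
    lower-correct a (inj₂ b) fa = contradiction (a , b , fa) none

    lower-injective : ∀ {a a′} → lower a (f a) ≡.refl ≡ lower a′ (f a′) ≡.refl → a ≡ a′
    lower-injective {a} {a′} eq = f-injective (begin
      f a                           ≡⟨ lower-correct a (f a) ≡.refl ⟨
      inj₁ (lower a (f a) ≡.refl)   ≡⟨ cong inj₁ eq ⟩
      inj₁ (lower a′ (f a′) ≡.refl) ≡⟨ lower-correct a′ (f a′) ≡.refl ⟩
      f a′                          ∎)
      where open ≡.≡-Reasoning

  funToFin-cong : ∀ {m n} {f g : Fin m → Fin n} → f ≗ g → funToFin f ≡ funToFin g
  funToFin-cong {zero}  _   = ≡.refl
  funToFin-cong {suc m} f≗g = cong₂ combine (f≗g zero) (funToFin-cong (f≗g ∘ suc))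

  ≗-injective⇒≤ : ∀ {m c q r} (f : Fin m → (Fin c → Fin q) → (Fin r → Fin q)) →
                  (∀ {j j′ w w′} → f j w ≗ f j′ w′ → j ≡ j′ × w ≗ w′) →
                  m * q ^ c ≤ q ^ r
  ≗-injective⇒≤ {m} {c} {q} {r} f f-injective = Fin.injective⇒≤ encode-injective
    where
    decode : Fin (m * q ^ c) → Fin r → Fin q
    decode x = f (proj₁ (remQuot {m} (q ^ c) x)) (finToFun (proj₂ (remQuot {m} (q ^ c) x)))

    encode-injective : ∀ {x y} → funToFin (decode x) ≡ funToFin (decode y) → x ≡ y
    encode-injective {x} {y} eq with f-injective decode-x≗decode-y
      where
      decode-x≗decode-y : decode x ≗ decode y
      decode-x≗decode-y i = begin
        decode x i                       ≡⟨ Fin.finToFun-funToFin (decode x) i ⟨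
        finToFun (funToFin (decode x)) i ≡⟨ cong (λ z → finToFun z i) eq ⟩
        finToFun (funToFin (decode y)) i ≡⟨ Fin.finToFun-funToFin (decode y) i ⟩
        decode y i                       ∎
        where open ≡.≡-Reasoning
    ... | j≡j′ , w≗w′ = begin
      x                             ≡⟨ Fin.combine-remQuot {m} (q ^ c) x ⟨
      combine (proj₁ rx) (proj₂ rx) ≡⟨ cong₂ combine j≡j′ w≡w′ ⟩
      combine (proj₁ ry) (proj₂ ry) ≡⟨ Fin.combine-remQuot {m} (q ^ c) y ⟩
      y                             ∎
      where
      open ≡.≡-Reasoning
      rx ry : Fin m × Fin (q ^ c)
      rx = remQuot {m} (q ^ c) x
      ry = remQuot {m} (q ^ c) y
      w≡w′ : proj₂ rx ≡ proj₂ ry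
      w≡w′ = ≡.trans (≡.sym (Fin.funToFin-finToFin {c} {q} (proj₂ rx)))
                     (≡.trans (funToFin-cong w≗w′) (Fin.funToFin-finToFin {c} {q} (proj₂ ry)))

  Splitting : ℕ → ℕ → ℕ → Set
  Splitting k l n = (Fin k ⊎ Fin l) ↔ Fin n

  module _ {k l n : ℕ} where

    place : Splitting k l n → Fin k ⊎ Fin l → Fin n
    place = Inverse.to

    locate : Splitting k l n → Fin n → Fin k ⊎ Fin l
    locate = Inverse.from

    module _ (π : Splitting k l n) where

      locate-place : ∀ x → locate π (place π x) ≡ x
      locate-place x = Inverse.inverseʳ π ≡.refl

      place-locate : ∀ y → place π (locate π y) ≡ y
      place-locate y = Inverse.inverseˡ π ≡.refl

      place-injective : ∀ {x y} → place π x ≡ place π y → x ≡ y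
      place-injective {x} {y} eq =
        ≡.trans (≡.sym (locate-place x)) (≡.trans (cong (locate π) eq) (locate-place y))

      locate-injective : ∀ {x y} → locate π x ≡ locate π y → x ≡ y
      locate-injective {x} {y} eq =
        ≡.trans (≡.sym (place-locate x)) (≡.trans (cong (place π) eq) (place-locate y))

      left : Fin k → Fin n
      left = place π ∘ inj₁

      right : Fin l → Fin n
      right = place π ∘ inj₂

  empty : Splitting 0 0 0
  empty = mk↔ₛ′ [ (λ ()) , (λ ()) ]′ (λ ()) (λ ()) λ { (inj₁ ()) ; (inj₂ ()) }

  swapSides : ∀ {k l n} → Splitting k l n → Splitting l k n
  swapSides = ↔-trans swap-↔

  putLeft : ∀ {k l n} → Splitting k l n → Splitting (suc k) l (suc n)
  putLeft {k} {l} {n} π = mk↔ₛ′ to from to∘from from∘to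
    where
    to : Fin (suc k) ⊎ Fin l → Fin (suc n)
    to (inj₁ zero)    = zero
    to (inj₁ (suc a)) = suc (place π (inj₁ a))
    to (inj₂ b)       = suc (place π (inj₂ b))

    from : Fin (suc n) → Fin (suc k) ⊎ Fin l
    from zero    = inj₁ zero
    from (suc x) = Sum.map₁ suc (locate π x)

    to-map₁ : ∀ y → to (Sum.map₁ suc y) ≡ suc (place π y)
    to-map₁ (inj₁ _) = ≡.refl
    to-map₁ (inj₂ _) = ≡.refl

    to∘from : ∀ x → to (from x) ≡ x
    to∘from zero    = ≡.refl
    to∘from (suc x) = ≡.trans (to-map₁ (locate π x)) (cong suc (place-locate π x))

    from∘to : ∀ y → from (to y) ≡ y
    from∘to (inj₁ zero)    = ≡.refl
    from∘to (inj₁ (suc a)) = cong (Sum.map₁ suc) (locate-place π (inj₁ a))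
    from∘to (inj₂ b)       = cong (Sum.map₁ suc) (locate-place π (inj₂ b))

  putRight : ∀ {k l n} → Splitting k l n → Splitting k (suc l) (suc n)
  putRight = swapSides ∘ putLeft ∘ swapSides

  shrinkˡ : ∀ k l {n} → suc k + l ≡ suc n → k + l ≡ n
  shrinkˡ _ _ = ℕ.suc-injective

  shrinkʳ : ∀ k l {n} → k + suc l ≡ suc n → k + l ≡ n
  shrinkʳ k l eq = ℕ.suc-injective (≡.trans (≡.sym (ℕ.+-suc k l)) eq)

  splittings : ∀ k l {n} → k + l ≡ n → Fin (pascal k l) → Splitting k l n
  splittings zero    zero    {zero}  _  _ = empty
  splittings zero    (suc l) {suc n} eq s = putRight (splittings zero l (shrinkʳ zero l eq) s)
  splittings (suc k) zero    {suc n} eq s = putLeft (splittings k zero (shrinkˡ k zero eq) s)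
  splittings (suc k) (suc l) {suc n} eq s with splitAt (pascal k (suc l)) s
  ... | inj₁ s₁ = putLeft (splittings k (suc l) (shrinkˡ k (suc l) eq) s₁)
  ... | inj₂ s₂ = putRight (splittings (suc k) l (shrinkʳ (suc k) l eq) s₂)

  data LeftMeetsRight {k l n} (π π′ : Splitting k l n) : Set where
    meet : ∀ a b → left π a ≡ right π′ b → LeftMeetsRight π π′

  module _ {k l n : ℕ} where

    putLeft-meets : {π π′ : Splitting k l n} → LeftMeetsRight π π′ →
                    LeftMeetsRight (putLeft π) (putLeft π′)
    putLeft-meets (meet a b eq) = meet (suc a) b (cong suc eq)

    putRight-meets : {π π′ : Splitting k l n} → LeftMeetsRight π π′ →
                     LeftMeetsRight (putRight π) (putRight π′)
    putRight-meets (meet a b eq) = meet a (suc b) (cong suc eq)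

    putLeft-meets-putRight : (π : Splitting k (suc l) n) (π′ : Splitting (suc k) l n) →
                             LeftMeetsRight (putLeft π) (putRight π′)
    putLeft-meets-putRight _ _ = meet zero zero ≡.refl

    -- The suc k values of left π cannot all lie in the k-element left block of π′.
    putRight-meets-putLeft : (π : Splitting (suc k) l n) (π′ : Splitting k (suc l) n) →
                             LeftMeetsRight (putRight π) (putLeft π′)
    putRight-meets-putLeft π π′
      with pigeonhole-⊎ (locate π′ ∘ left π)
                        (inj₁-injective ∘ place-injective π ∘ locate-injective π′)
    ... | a , b , eq =
      meet a b (cong suc (≡.trans (≡.sym (place-locate π′ (left π a))) (cong (place π′) eq)))

  splittings-meet : ∀ k l {n} (eq : k + l ≡ n) {s s′} → s ≢ s′ →
                    LeftMeetsRight (splittings k l eq s) (splittings k l eq s′)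
  splittings-meet zero    zero    {zero}  _  {zero} {zero} s≢s′ = contradiction ≡.refl s≢s′
  splittings-meet zero    (suc l) {suc n} eq s≢s′ =
    putRight-meets (splittings-meet zero l (shrinkʳ zero l eq) s≢s′)
  splittings-meet (suc k) zero    {suc n} eq s≢s′ =
    putLeft-meets (splittings-meet k zero (shrinkˡ k zero eq) s≢s′)
  splittings-meet (suc k) (suc l) {suc n} eq {s} {s′} s≢s′
    with splitAt (pascal k (suc l)) s in e | splitAt (pascal k (suc l)) s′ in e′
  ... | inj₁ _ | inj₁ _ = putLeft-meets
    (splittings-meet k (suc l) (shrinkˡ k (suc l) eq) (splitAt-≢ e e′ s≢s′ ∘ cong inj₁))
  ... | inj₂ _ | inj₂ _ = putRight-meets
    (splittings-meet (suc k) l (shrinkʳ (suc k) l eq) (splitAt-≢ e e′ s≢s′ ∘ cong inj₂))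
  ... | inj₁ s₁ | inj₂ s₂′ = putLeft-meets-putRight (splittings k (suc l) (shrinkˡ k (suc l) eq) s₁)
                                                    (splittings (suc k) l (shrinkʳ (suc k) l eq) s₂′)
  ... | inj₂ s₂ | inj₁ s₁′ = putRight-meets-putLeft (splittings (suc k) l (shrinkʳ (suc k) l eq) s₂)
                                                    (splittings k (suc l) (shrinkˡ k (suc l) eq) s₁′)

module FieldAlgebra {c ℓ} (F : Field c ℓ) where

  open Field F hiding (zero)
  open TensorDefs F using (Σᶠ; Πᶠ)
  open import Algebra.Properties.Ring ring using (-‿involutive; -0#≈0#; -‿distribˡ-*; -‿+-comm; +-cancelʳ)
  open import Algebra.Properties.CommutativeSemigroup +-commutativeSemigroup
    using () renaming (interchange to +-interchange)
  open import Relation.Binary.Reasoning.Setoid setoid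

  1≉0 : 1# ≉ 0#
  1≉0 = 0≉1 ∘ sym

  -1≉0 : - 1# ≉ 0#
  -1≉0 -1≈0 = 1≉0 (begin
    1#     ≈⟨ -‿involutive 1# ⟨
    - - 1# ≈⟨ -‿cong -1≈0 ⟩
    - 0#   ≈⟨ -0#≈0# ⟩
    0#     ∎)

  *-cancelˡ : ∀ {a x y} → a ≉ 0# → a * x ≈ a * y → x ≈ y
  *-cancelˡ {a} {x} {y} a≉0 ax≈ay with inverse a a≉0
  ... | a⁻¹ , aa⁻¹≈1 = begin
    x             ≈⟨ undo x ⟨
    a⁻¹ * (a * x) ≈⟨ *-congˡ ax≈ay ⟩
    a⁻¹ * (a * y) ≈⟨ undo y ⟩
    y             ∎
    where
    undo : ∀ z → a⁻¹ * (a * z) ≈ z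
    undo z = begin
      a⁻¹ * (a * z) ≈⟨ *-assoc a⁻¹ a z ⟨
      (a⁻¹ * a) * z ≈⟨ *-congʳ (trans (*-comm a⁻¹ a) aa⁻¹≈1) ⟩
      1# * z        ≈⟨ *-identityˡ z ⟩
      z             ∎

  x*y≉0 : ∀ {x y} → x ≉ 0# → y ≉ 0# → x * y ≉ 0#
  x*y≉0 {x} x≉0 y≉0 xy≈0 = y≉0 (*-cancelˡ x≉0 (trans xy≈0 (sym (zeroʳ x))))

  x+u≈y+v⇒u≉v : ∀ {x y u v} → x ≈ 0# → y ≉ 0# → x + u ≈ y + v → u ≉ v
  x+u≈y+v⇒u≉v {x} {y} {u} {v} x≈0 y≉0 x+u≈y+v u≈v = y≉0 (sym (+-cancelʳ v 0# y (begin
    0# + v ≈⟨ +-cong x≈0 u≈v ⟨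
    x + u  ≈⟨ x+u≈y+v ⟩
    y + v  ∎)))

  [x-y]+[y+z]≈x+z : ∀ x y z → (x - y) + (y + z) ≈ x + z
  [x-y]+[y+z]≈x+z x y z = begin
    (x - y) + (y + z)   ≈⟨ +-assoc x (- y) (y + z) ⟩
    x + (- y + (y + z)) ≈⟨ +-congˡ (+-assoc (- y) y z) ⟨
    x + ((- y + y) + z) ≈⟨ +-congˡ (+-congʳ (-‿inverseˡ y)) ⟩
    x + (0# + z)        ≈⟨ +-congˡ (+-identityˡ z) ⟩
    x + z               ∎

  x+a≈y+b⇒a-b≈y-x : ∀ {x y a b} → x + a ≈ y + b → a - b ≈ y - x
  x+a≈y+b⇒a-b≈y-x {x} {y} {a} {b} eq = +-cancelʳ (b + x) (a - b) (y - x) (begin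
    (a - b) + (b + x) ≈⟨ [x-y]+[y+z]≈x+z a b x ⟩
    a + x             ≈⟨ +-comm a x ⟩
    x + a             ≈⟨ eq ⟩
    y + b             ≈⟨ [x-y]+[y+z]≈x+z y x b ⟨
    (y - x) + (x + b) ≈⟨ +-congˡ (+-comm x b) ⟩
    (y - x) + (b + x) ∎)

  -- (a − b)(d − c) = 0, and d − c is invertible.
  a*d+b*c≈a*c+b*d⇒a≈b : ∀ {a b c d} → c ≉ d → a * d + b * c ≈ a * c + b * d → a ≈ b
  a*d+b*c≈a*c+b*d⇒a≈b {a} {b} {c} {d} c≉d hyp =
    *-cancelˡ δ≉0 (+-cancelʳ (a * c + b * c) (δ * a) (δ * b) (begin
      δ * a + (a * c + b * c) ≈⟨ shift a b ⟩
      a * (δ + c) + b * c     ≈⟨ +-congʳ (*-congˡ δ+c≈d) ⟩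
      a * d + b * c           ≈⟨ hyp ⟩
      a * c + b * d           ≈⟨ +-congˡ (*-congˡ δ+c≈d) ⟨
      a * c + b * (δ + c)     ≈⟨ shift′ b a ⟨
      δ * b + (a * c + b * c) ∎))
    where
    open import Algebra.Solver.Ring.NaturalCoefficients.Default commutativeSemiring
    δ : Carrier
    δ = d - c
    δ+c≈d : δ + c ≈ d
    δ+c≈d = trans (+-congˡ (sym (+-identityʳ c))) (trans ([x-y]+[y+z]≈x+z d c 0#) (+-identityʳ d))
    δ≉0 : δ ≉ 0#
    δ≉0 δ≈0 = c≉d (trans (sym (+-identityˡ c)) (trans (+-congʳ (sym δ≈0)) δ+c≈d))
    shift : ∀ x y → δ * x + (x * c + y * c) ≈ x * (δ + c) + y * c
    shift = solve 4 (λ δ c x y → δ :* x :+ (x :* c :+ y :* c) := x :* (δ :+ c) :+ y :* c) refl δ c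
    shift′ : ∀ x y → δ * x + (y * c + x * c) ≈ y * c + x * (δ + c)
    shift′ = solve 4 (λ δ c x y → δ :* x :+ (y :* c :+ x :* c) := y :* c :+ x :* (δ :+ c)) refl δ c

  Σᶠ-cong : ∀ {m} {f g : Fin m → Carrier} → (∀ a → f a ≈ g a) → Σᶠ f ≈ Σᶠ g
  Σᶠ-cong {zero}  _   = refl
  Σᶠ-cong {suc m} f≈g = +-cong (f≈g zero) (Σᶠ-cong (f≈g ∘ suc))

  Πᶠ-cong : ∀ {m} {f g : Fin m → Carrier} → (∀ a → f a ≈ g a) → Πᶠ f ≈ Πᶠ g
  Πᶠ-cong {zero}  _   = refl
  Πᶠ-cong {suc m} f≈g = *-cong (f≈g zero) (Πᶠ-cong (f≈g ∘ suc))

  Σᶠ-zero : ∀ {m} {f : Fin m → Carrier} → (∀ a → f a ≈ 0#) → Σᶠ f ≈ 0#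
  Σᶠ-zero {zero}  _   = refl
  Σᶠ-zero {suc m} f≈0 = trans (+-cong (f≈0 zero) (Σᶠ-zero (f≈0 ∘ suc))) (+-identityʳ 0#)

  Σᶠ-single : ∀ {m} (f : Fin m → Carrier) a → (∀ b → b ≢ a → f b ≈ 0#) → Σᶠ f ≈ f a
  Σᶠ-single f zero    others = trans (+-congˡ (Σᶠ-zero λ b → others (suc b) λ ())) (+-identityʳ (f zero))
  Σᶠ-single f (suc a) others = begin
    f zero + Σᶠ (f ∘ suc) ≈⟨ +-congʳ (others zero λ ()) ⟩
    0# + Σᶠ (f ∘ suc)     ≈⟨ +-identityˡ _ ⟩
    Σᶠ (f ∘ suc)          ≈⟨ Σᶠ-single (f ∘ suc) a others-suc ⟩
    f (suc a)             ∎
    where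
    others-suc : ∀ b → b ≢ a → f (suc b) ≈ 0#
    others-suc b b≢a = others (suc b) (b≢a ∘ Fin.suc-injective)

  Σᶠ-distrib-+ : ∀ {m} (f g : Fin m → Carrier) → Σᶠ (λ a → f a + g a) ≈ Σᶠ f + Σᶠ g
  Σᶠ-distrib-+ {zero}  f g = sym (+-identityʳ 0#)
  Σᶠ-distrib-+ {suc m} f g = trans (+-congˡ (Σᶠ-distrib-+ (f ∘ suc) (g ∘ suc)))
                                   (+-interchange (f zero) (g zero) (Σᶠ (f ∘ suc)) (Σᶠ (g ∘ suc)))

  Σᶠ-distribˡ : ∀ {m} x (f : Fin m → Carrier) → x * Σᶠ f ≈ Σᶠ (λ a → x * f a)
  Σᶠ-distribˡ {zero}  x f = zeroʳ x
  Σᶠ-distribˡ {suc m} x f =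
    trans (distribˡ x (f zero) (Σᶠ (f ∘ suc))) (+-congˡ (Σᶠ-distribˡ x (f ∘ suc)))

  Σᶠ-distribʳ : ∀ {m} x (f : Fin m → Carrier) → Σᶠ f * x ≈ Σᶠ (λ a → f a * x)
  Σᶠ-distribʳ {zero}  x f = zeroˡ x
  Σᶠ-distribʳ {suc m} x f =
    trans (distribʳ x (f zero) (Σᶠ (f ∘ suc))) (+-congˡ (Σᶠ-distribʳ x (f ∘ suc)))

  Σᶠ-comm : ∀ {m m′} (f : Fin m → Fin m′ → Carrier) →
            Σᶠ (λ a → Σᶠ (λ b → f a b)) ≈ Σᶠ (λ b → Σᶠ (λ a → f a b))
  Σᶠ-comm {zero}  {m′} f = sym (Σᶠ-zero {m′} λ _ → refl)
  Σᶠ-comm {suc m}      f = begin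
    Σᶠ (f zero) + Σᶠ (λ a → Σᶠ (f (suc a)))         ≈⟨ +-congˡ (Σᶠ-comm (f ∘ suc)) ⟩
    Σᶠ (f zero) + Σᶠ (λ b → Σᶠ (λ a → f (suc a) b)) ≈⟨ Σᶠ-distrib-+ (f zero) _ ⟨
    Σᶠ (λ b → f zero b + Σᶠ (λ a → f (suc a) b))    ∎

  Σᶠ-[x-y]*w : ∀ {m} (x y w : Fin m → Carrier) →
               Σᶠ (λ a → (x a - y a) * w a) ≈ Σᶠ (λ a → x a * w a) - Σᶠ (λ a → y a * w a)
  Σᶠ-[x-y]*w {zero}  x y w = sym (trans (+-congˡ -0#≈0#) (+-identityʳ 0#))
  Σᶠ-[x-y]*w {suc m} x y w = begin
    (x₀ - y₀) * w₀ + Σᶠ (λ a → (x (suc a) - y (suc a)) * w (suc a))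
      ≈⟨ +-cong (trans (distribʳ w₀ x₀ (- y₀)) (+-congˡ (sym (-‿distribˡ-* y₀ w₀))))
                (Σᶠ-[x-y]*w (x ∘ suc) (y ∘ suc) (w ∘ suc)) ⟩
    (x₀ * w₀ - y₀ * w₀) + (X - Y)
      ≈⟨ +-interchange (x₀ * w₀) (- (y₀ * w₀)) X (- Y) ⟩
    (x₀ * w₀ + X) + (- (y₀ * w₀) + - Y)
      ≈⟨ +-congˡ (-‿+-comm (y₀ * w₀) Y) ⟩
    (x₀ * w₀ + X) - (y₀ * w₀ + Y) ∎
    where
    x₀ y₀ w₀ X Y : Carrier
    x₀ = x zero
    y₀ = y zero
    w₀ = w zero
    X = Σᶠ (λ a → x (suc a) * w (suc a))
    Y = Σᶠ (λ a → y (suc a) * w (suc a))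

  Πᶠ-zero : ∀ {m} (f : Fin m → Carrier) a → f a ≈ 0# → Πᶠ f ≈ 0#
  Πᶠ-zero f zero    fa≈0 = trans (*-congʳ fa≈0) (zeroˡ _)
  Πᶠ-zero f (suc a) fa≈0 = trans (*-congˡ (Πᶠ-zero (f ∘ suc) a fa≈0)) (zeroʳ _)

  Πᶠ≉0 : ∀ {m} (f : Fin m → Carrier) → (∀ a → f a ≉ 0#) → Πᶠ f ≉ 0#
  Πᶠ≉0 {zero}  f _   = 1≉0
  Πᶠ≉0 {suc m} f f≉0 = x*y≉0 (f≉0 zero) (Πᶠ≉0 (f ∘ suc) (f≉0 ∘ suc))

  Πᶠ-++ : ∀ k {l} (f : Fin (k ℕ.+ l) → Carrier) →
          Πᶠ f ≈ Πᶠ (λ a → f (a ↑ˡ l)) * Πᶠ (λ b → f (k ↑ʳ b))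
  Πᶠ-++ zero    f = sym (*-identityˡ (Πᶠ f))
  Πᶠ-++ (suc k) f = trans (*-congˡ (Πᶠ-++ k (f ∘ suc))) (sym (*-assoc (f zero) _ _))

  module Enumeration {q} (card : HasCardinality F q) where

    enum : Fin q → Carrier
    enum = proj₁ card

    enum-injective : ∀ {i j} → enum i ≈ enum j → i ≡ j
    enum-injective = proj₁ (proj₂ card) _ _

    index : Carrier → Fin q
    index x = proj₁ (proj₂ (proj₂ card) x)

    enum-index : ∀ x → enum (index x) ≈ x
    enum-index x = proj₂ (proj₂ (proj₂ card) x)

    index-injective : ∀ {x y} → index x ≡ index y → x ≈ y
    index-injective {x} {y} eq = begin
      x              ≈⟨ enum-index x ⟨
      enum (index x) ≡⟨ ≡.cong enum eq ⟩
      enum (index y) ≈⟨ enum-index y ⟩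
      y              ∎

    _≟_ : ∀ x y → Dec (x ≈ y)
    x ≟ y with index x Fin.≟ index y
    ... | yes eq = yes (index-injective eq)
    ... | no  ne = no λ x≈y → ne (enum-injective (trans (enum-index x) (trans x≈y (sym (enum-index y)))))

    2≤q : 2 ≤ q
    2≤q = two-distinct (index 0#) (index 1#) (0≉1 ∘ index-injective)
      where
      two-distinct : ∀ {p} (i j : Fin p) → i ≢ j → 2 ≤ p
      two-distinct {suc zero}    zero zero i≢j = contradiction ≡.refl i≢j
      two-distinct {suc (suc _)} _    _    _   = ℕ.s≤s (ℕ.s≤s ℕ.z≤n)

module Tensors {c ℓ} (F : Field c ℓ) where

  open Field F hiding (zero)
  open TensorDefs F
  open FieldAlgebra F
  open import Data.Fin using (_<_; _<?_)
  open import Relation.Binary.Definitions using (tri<; tri≈; tri>)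
  open import Algebra.Properties.Ring ring using (-‿distribˡ-*)

  ε-refl : ∀ {n} (x : Fin n) → ε x x ≈ 0#
  ε-refl x with x Fin.≟ x
  ... | yes _   = refl
  ... | no  x≢x = contradiction ≡.refl x≢x

  ε≉0 : ∀ {n} {x y : Fin n} → x ≢ y → ε x y ≉ 0#
  ε≉0 {x = x} {y} x≢y with x Fin.≟ y
  ... | yes x≡y = contradiction x≡y x≢y
  ... | no  _ with x <? y
  ...   | yes _ = 1≉0
  ...   | no  _ = -1≉0

  -- `levi` multiplies a factor defined in its where-block; unification recovers that factor.
  levi-as-product : ∀ {n} (i : Fin n → Fin n) →
                    ∃ λ (g : Fin n → Fin n → Carrier) → levi i ≡ Πᶠ (λ a → Πᶠ (λ b → g a b))
  levi-as-product i = _ , ≡.refl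

  pairFactor : ∀ {n} → (Fin n → Fin n) → Fin n → Fin n → Carrier
  pairFactor i = proj₁ (levi-as-product i)

  pairFactor-< : ∀ {n} (i : Fin n → Fin n) {a b} → a < b → pairFactor i a b ≈ ε (i a) (i b)
  pairFactor-< i {a} {b} a<b with a <? b
  ... | yes _   = refl
  ... | no  a≮b = contradiction a<b a≮b

  pairFactor-≮ : ∀ {n} (i : Fin n → Fin n) {a b} → ¬ a < b → pairFactor i a b ≈ 1#
  pairFactor-≮ i {a} {b} a≮b with a <? b
  ... | yes a<b = contradiction a<b a≮b
  ... | no  _   = refl

  levi-collapse : ∀ {n} (i : Fin n → Fin n) {a b} → a ≢ b → i a ≡ i b → levi i ≈ 0#
  levi-collapse i {a} {b} a≢b ia≡ib with Fin.<-cmp a b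
  ... | tri< a<b _ _ = Πᶠ-zero _ a (Πᶠ-zero _ b (trans (pairFactor-< i a<b)
                         (≡.subst (λ z → ε (i a) z ≈ 0#) ia≡ib (ε-refl (i a)))))
  ... | tri≈ _ a≡b _ = contradiction a≡b a≢b
  ... | tri> _ _ b<a = Πᶠ-zero _ b (Πᶠ-zero _ a (trans (pairFactor-< i b<a)
                         (≡.subst (λ z → ε z (i a) ≈ 0#) ia≡ib (ε-refl (i a)))))

  levi≉0 : ∀ {n} (i : Fin n → Fin n) → (∀ {a b} → i a ≡ i b → a ≡ b) → levi i ≉ 0#
  levi≉0 i i-injective = Πᶠ≉0 _ λ a → Πᶠ≉0 _ λ b → factor≉0 (a <? b)
    where
    factor≉0 : ∀ {a b} → Dec (a < b) → pairFactor i a b ≉ 0#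
    factor≉0 (yes a<b) = ε≉0 (Fin.<⇒≢ a<b ∘ i-injective) ∘ trans (sym (pairFactor-< i a<b))
    factor≉0 (no  a≮b) = 1≉0 ∘ trans (sym (pairFactor-≮ i a≮b))

  elementary′ : ∀ {l n} → (Fin l → Vecᶠ n) → (Fin l → Fin n) → Carrier
  elementary′ β J = Πᶠ (λ b → β b (J b))

  negateFirst : ∀ {l n} → (Fin (suc l) → Vecᶠ n) → Fin (suc l) → Vecᶠ n
  negateFirst β zero    x = - β zero x
  negateFirst β (suc b) x = β (suc b) x

  elementary′-negateFirst : ∀ {l n} (β : Fin (suc l) → Vecᶠ n) J →
                            elementary′ (negateFirst β) J ≈ - elementary′ β J
  elementary′-negateFirst β J = sym (-‿distribˡ-* (β zero (J zero)) _)

module Det₃ {c ℓ} (F : Field c ℓ) where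

  open Field F hiding (zero)
  open FieldAlgebra F
  open import Data.Vec.Functional using ([]; _∷_)
  open import Data.Empty using (⊥)
  open import Relation.Binary.Reasoning.Setoid setoid

  -- For the matrix r_x c_y l + s_x e_y w, writing r, r′ for r_x, r_x′ and so on, the minor on rows
  -- x, x′ and columns y, y′ is l w (r s′ − r′ s)(c e′ − c′ e); it is stated without subtraction
  -- for the semiring solver.
  rank-two-minor : ∀ r r′ s s′ c c′ e e′ l w →
    (r * (c * l) + s * (e * w)) * (r′ * (c′ * l) + s′ * (e′ * w))
      + (l * w) * ((r * s′) * (c′ * e) + (r′ * s) * (c * e′))
    ≈ (r * (c′ * l) + s * (e′ * w)) * (r′ * (c * l) + s′ * (e * w))
      + (l * w) * ((r * s′) * (c * e′) + (r′ * s) * (c′ * e))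
  rank-two-minor = solve 10 (λ r r′ s s′ c c′ e e′ l w →
    (r :* (c :* l) :+ s :* (e :* w)) :* (r′ :* (c′ :* l) :+ s′ :* (e′ :* w))
      :+ (l :* w) :* ((r :* s′) :* (c′ :* e) :+ (r′ :* s) :* (c :* e′))
    := (r :* (c′ :* l) :+ s :* (e′ :* w)) :* (r′ :* (c :* l) :+ s′ :* (e :* w))
      :+ (l :* w) :* ((r :* s′) :* (c :* e′) :+ (r′ :* s) :* (c′ :* e))) refl
    where open import Algebra.Solver.Ring.NaturalCoefficients.Default commutativeSemiring

  module _ (N : (Fin 3 → Fin 3) → Carrier) (r c l s e w : Fin 3 → Carrier)
           (rank-two : ∀ (π : Fin 3 → Fin 3) →
                       N π ≈ r (π 0F) * (c (π 1F) * l (π 2F)) + s (π 0F) * (e (π 1F) * w (π 2F)))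
           (vanishes : ∀ (π : Fin 3 → Fin 3) {t t′ : Fin 3} → t ≢ t′ → π t ≡ π t′ → N π ≈ 0#)
           (nonvanishing : ∀ (π π⁻¹ : Fin 3 → Fin 3) →
                           (∀ t → π (π⁻¹ t) ≡ t) → (∀ t → π⁻¹ (π t) ≡ t) → N π ≉ 0#)
           where

    private
      n : Fin 3 → Fin 3 → Fin 3 → Carrier
      n x y z = N (x ∷ y ∷ z ∷ [])

      K : Fin 3 → Carrier
      K z = l z * w z

      ρ κ : Fin 3 → Fin 3 → Carrier
      ρ x x′ = r x * s x′
      κ y y′ = c y * e y′

      minor : ∀ x x′ y y′ z →
        n x y z * n x′ y′ z + K z * (ρ x x′ * κ y′ y + ρ x′ x * κ y y′)
        ≈ n x y′ z * n x′ y z + K z * (ρ x x′ * κ y y′ + ρ x′ x * κ y′ y)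
      minor x x′ y y′ z = begin
        n x y z * n x′ y′ z + _ ≈⟨ +-congʳ (*-cong (rank-two _) (rank-two _)) ⟩
        _                       ≈⟨ rank-two-minor (r x) (r x′) (s x) (s x′) (c y) (c y′)
                                                  (e y) (e y′) (l z) (w z) ⟩
        _                       ≈⟨ +-congʳ (*-cong (rank-two _) (rank-two _)) ⟨
        n x y′ z * n x′ y z + _ ∎

      n₀₀₂≈0 : n 0F 0F 2F ≈ 0#
      n₀₀₂≈0 = vanishes _ {0F} {1F} (λ ()) ≡.refl

      n₁₁₂≈0 : n 1F 1F 2F ≈ 0#
      n₁₁₂≈0 = vanishes _ {0F} {1F} (λ ()) ≡.refl

      n₂₁₂≈0 : n 2F 1F 2F ≈ 0#
      n₂₁₂≈0 = vanishes _ {0F} {2F} (λ ()) ≡.refl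

      n₁₁₀≈0 : n 1F 1F 0F ≈ 0#
      n₁₁₀≈0 = vanishes _ {0F} {1F} (λ ()) ≡.refl

      involution≉0 : ∀ π → (∀ t → π (π t) ≡ t) → N π ≉ 0#
      involution≉0 π π∘π≗id = nonvanishing π π π∘π≗id π∘π≗id

      n₀₁₂≉0 : n 0F 1F 2F ≉ 0#
      n₀₁₂≉0 = involution≉0 _ λ { 0F → ≡.refl ; 1F → ≡.refl ; 2F → ≡.refl }

      n₁₀₂≉0 : n 1F 0F 2F ≉ 0#
      n₁₀₂≉0 = involution≉0 _ λ { 0F → ≡.refl ; 1F → ≡.refl ; 2F → ≡.refl }

      n₂₁₀≉0 : n 2F 1F 0F ≉ 0#
      n₂₁₀≉0 = involution≉0 _ λ { 0F → ≡.refl ; 1F → ≡.refl ; 2F → ≡.refl }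

      n₁₂₀≉0 : n 1F 2F 0F ≉ 0#
      n₁₂₀≉0 = nonvanishing _ (2F ∷ 0F ∷ 1F ∷ [])
        (λ { 0F → ≡.refl ; 1F → ≡.refl ; 2F → ≡.refl })
        (λ { 0F → ≡.refl ; 1F → ≡.refl ; 2F → ≡.refl })

      slice₂-rows₀₁ : K 2F * (ρ 0F 1F * κ 1F 0F + ρ 1F 0F * κ 0F 1F)
                    ≉ K 2F * (ρ 0F 1F * κ 0F 1F + ρ 1F 0F * κ 1F 0F)
      slice₂-rows₀₁ = x+u≈y+v⇒u≉v (trans (*-congʳ n₀₀₂≈0) (zeroˡ _)) (x*y≉0 n₀₁₂≉0 n₁₀₂≉0)
                                  (minor 0F 1F 0F 1F 2F)

      K₂≉0 : K 2F ≉ 0#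
      K₂≉0 K₂≈0 = slice₂-rows₀₁ (trans (K₂*≈0 _) (sym (K₂*≈0 _)))
        where
        K₂*≈0 : ∀ x → K 2F * x ≈ 0#
        K₂*≈0 x = trans (*-congʳ K₂≈0) (zeroˡ x)

      κ₀₁≉κ₁₀ : κ 0F 1F ≉ κ 1F 0F
      κ₀₁≉κ₁₀ κ₀₁≈κ₁₀ = slice₂-rows₀₁ (*-congˡ (+-cong (*-congˡ (sym κ₀₁≈κ₁₀)) (*-congˡ κ₀₁≈κ₁₀)))

      ρ₁₂≈ρ₂₁ : ρ 1F 2F ≈ ρ 2F 1F
      ρ₁₂≈ρ₂₁ = a*d+b*c≈a*c+b*d⇒a≈b κ₀₁≉κ₁₀ (*-cancelˡ K₂≉0 (begin
        K 2F * (ρ 1F 2F * κ 1F 0F + ρ 2F 1F * κ 0F 1F) ≈⟨ +-identityˡ _ ⟨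
        0# + _                                         ≈⟨ +-congʳ (trans (*-congˡ n₂₁₂≈0) (zeroʳ _)) ⟨
        n 1F 0F 2F * n 2F 1F 2F + _                    ≈⟨ minor 1F 2F 0F 1F 2F ⟩
        n 1F 1F 2F * n 2F 0F 2F + _                    ≈⟨ +-congʳ (trans (*-congʳ n₁₁₂≈0) (zeroˡ _)) ⟩
        0# + _                                         ≈⟨ +-identityˡ _ ⟩
        K 2F * (ρ 1F 2F * κ 0F 1F + ρ 2F 1F * κ 1F 0F) ∎))

    det₃-support-rank>2 : ⊥
    det₃-support-rank>2 =
      x+u≈y+v⇒u≉v (trans (*-congʳ n₁₁₀≈0) (zeroˡ _)) (x*y≉0 n₁₂₀≉0 n₂₁₀≉0) (minor 1F 2F 1F 2F 0F)
        (*-congˡ (begin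
          ρ 1F 2F * κ 2F 1F + ρ 2F 1F * κ 1F 2F ≈⟨ +-cong (*-congʳ ρ₁₂≈ρ₂₁) (*-congʳ (sym ρ₁₂≈ρ₂₁)) ⟩
          ρ 2F 1F * κ 2F 1F + ρ 1F 2F * κ 1F 2F ≈⟨ +-comm _ _ ⟩
          ρ 1F 2F * κ 1F 2F + ρ 2F 1F * κ 2F 1F ∎))

-- The last l = 3 + m positions are written so that a product over them unfolds definitionally in
-- its first three factors, which are the ones permuted in the det₃ argument.
module Flattening {c ℓ} (F : Field c ℓ) (k m : ℕ) {r : ℕ}
                  (D : TensorDefs.HasRankDecomp F (TensorDefs.det F (k ℕ.+ (3 ℕ.+ m))) r) where

  open Field F hiding (zero)
  open TensorDefs F
  open FieldAlgebra F
  open Tensors F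
  open Det₃ F
  open Combinatorics
  open Arithmetic using (pascal)
  open import Relation.Nullary.Decidable using (decidable-stable)
  open import Algebra.Properties.Ring ring using (+-cancelʳ; x∙y⁻¹≈ε⇒x≈y)
  open import Relation.Binary.Reasoning.Setoid setoid

  l n : ℕ
  l = 3 ℕ.+ m
  n = k ℕ.+ l

  v : Fin r → Fin n → Vecᶠ n
  v = proj₁ D

  permute₃ : (Fin 3 → Fin 3) → Fin l → Fin l
  permute₃ = permuteˡ {3} {m}

  glue : (Fin k → Fin n) → (Fin l → Fin n) → Fin n → Fin n
  glue I J = [ I , J ]′ ∘ splitAt k

  glue-↑ˡ : ∀ I J a → glue I J (a ↑ˡ l) ≡ I a
  glue-↑ˡ I J a = cong [ I , J ]′ (Fin.splitAt-↑ˡ k a l)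

  glue-↑ʳ : ∀ I J b → glue I J (k ↑ʳ b) ≡ J b
  glue-↑ʳ I J b = cong [ I , J ]′ (Fin.splitAt-↑ʳ k l b)

  leftFactor : Fin r → (Fin k → Fin n) → Carrier
  leftFactor j I = Πᶠ (λ a → v j (a ↑ˡ l) (I a))

  rightFactor : Fin r → (Fin l → Fin n) → Carrier
  rightFactor j = elementary′ (λ b → v j (k ↑ʳ b))

  levi-glue : ∀ I J → levi (glue I J) ≈ Σᶠ (λ j → leftFactor j I * rightFactor j J)
  levi-glue I J = begin
    levi (glue I J)                             ≈⟨ proj₂ D (glue I J) ⟨
    Σᶠ (λ j → Πᶠ (λ p → v j p (glue I J p)))    ≈⟨ Σᶠ-cong (λ j → trans (Πᶠ-++ k _) (*-cong
      (Πᶠ-cong λ a → reflexive (cong (v j (a ↑ˡ l)) (glue-↑ˡ I J a)))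
      (Πᶠ-cong λ b → reflexive (cong (v j (k ↑ʳ b)) (glue-↑ʳ I J b))))) ⟩
    Σᶠ (λ j → leftFactor j I * rightFactor j J) ∎

  C : ℕ
  C = pascal k l

  split : Fin C → Splitting k l n
  split = splittings k l ≡.refl

  T : (Fin C → Carrier) → (Fin l → Fin n) → Carrier
  T u J = Σᶠ (λ s → u s * levi (glue (left (split s)) J))

  L : (Fin C → Carrier) → Fin r → Carrier
  L u j = Σᶠ (λ s → u s * leftFactor j (left (split s)))

  T-expand : ∀ u J → T u J ≈ Σᶠ (λ j → L u j * rightFactor j J)
  T-expand u J = begin
    Σᶠ (λ s → u s * levi (glue (I s) J))
      ≈⟨ Σᶠ-cong (λ s → trans (*-congˡ (levi-glue (I s) J)) (Σᶠ-distribˡ (u s) (summand s))) ⟩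
    Σᶠ (λ s → Σᶠ (λ j → u s * summand s j))
      ≈⟨ Σᶠ-comm (λ s j → u s * summand s j) ⟩
    Σᶠ (λ j → Σᶠ (λ s → u s * summand s j))
      ≈⟨ Σᶠ-cong (λ j → trans (Σᶠ-cong λ s → sym (*-assoc (u s) (leftFactor j (I s)) (rightFactor j J)))
                              (sym (Σᶠ-distribʳ (rightFactor j J) (λ s → u s * leftFactor j (I s))))) ⟩
    Σᶠ (λ j → L u j * rightFactor j J) ∎
    where
    I : Fin C → Fin k → Fin n
    I = left ∘ split
    summand : Fin C → Fin r → Carrier
    summand s j = leftFactor j (I s) * rightFactor j J

  glue-collapse : ∀ I J π {t t′} → t ≢ t′ → π t ≡ π t′ → levi (glue I (J ∘ permute₃ π)) ≈ 0#
  glue-collapse I J π {t} {t′} t≢t′ πt≡πt′ =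
    levi-collapse _ (t≢t′ ∘ Fin.↑ˡ-injective m t t′ ∘ Fin.↑ʳ-injective k _ _)
      (≡.trans (value t) (≡.trans (cong (λ x → J (x ↑ˡ m)) πt≡πt′) (≡.sym (value t′))))
    where
    value : ∀ t → glue I (J ∘ permute₃ π) (k ↑ʳ (t ↑ˡ m)) ≡ J (π t ↑ˡ m)
    value t = ≡.trans (glue-↑ʳ I _ _) (cong J (permuteˡ-↑ˡ π t))

  glue-off-diagonal : ∀ {s s′} → s ≢ s′ → ∀ σ σ⁻¹ → (∀ t → σ (σ⁻¹ t) ≡ t) →
                      levi (glue (left (split s)) (right (split s′) ∘ permute₃ σ)) ≈ 0#
  glue-off-diagonal {s} {s′} s≢s′ σ σ⁻¹ σ∘σ⁻¹≗id with splittings-meet k l ≡.refl s≢s′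
  ... | meet a b a-meets-b = levi-collapse _ (↑ˡ≢↑ʳ a (permute₃ σ⁻¹ b))
    (≡.trans (glue-↑ˡ I J a) (≡.trans a-meets-b (≡.trans
      (cong (right (split s′)) (≡.sym (permuteˡ-inverse σ σ⁻¹ σ∘σ⁻¹≗id b)))
      (≡.sym (glue-↑ʳ I J _)))))
    where
    I : Fin k → Fin n
    I = left (split s)
    J : Fin l → Fin n
    J = right (split s′) ∘ permute₃ σ

  glue-diagonal : ∀ (π : Splitting k l n) ρ p →
                  glue (left π) (right π ∘ ρ) p ≡ place π (Sum.map₂ ρ (splitAt k p))
  glue-diagonal π ρ p with splitAt k p
  ... | inj₁ _ = ≡.refl
  ... | inj₂ _ = ≡.refl

  glue-diagonal≉0 : ∀ s σ σ⁻¹ → (∀ t → σ⁻¹ (σ t) ≡ t) →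
                    levi (glue (left (split s)) (right (split s) ∘ permute₃ σ)) ≉ 0#
  glue-diagonal≉0 s σ σ⁻¹ σ⁻¹∘σ≗id = levi≉0 _ λ {p} {p′} eq →
    splitAt-injective k (map₂-injective permute₃-injective (place-injective π
      (≡.trans (≡.sym (glue-diagonal π _ p)) (≡.trans eq (glue-diagonal π _ p′)))))
    where
    π : Splitting k l n
    π = split s
    permute₃-injective : ∀ {b b′} → permute₃ σ b ≡ permute₃ σ b′ → b ≡ b′
    permute₃-injective {b} {b′} eq = ≡.trans (≡.sym (permuteˡ-inverse σ⁻¹ σ σ⁻¹∘σ≗id b))
      (≡.trans (cong (permute₃ σ⁻¹) eq) (permuteˡ-inverse σ⁻¹ σ σ⁻¹∘σ≗id b′))

  T-collapse : ∀ u J π {t t′} → t ≢ t′ → π t ≡ π t′ → T u (J ∘ permute₃ π) ≈ 0#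
  T-collapse u J π t≢t′ πt≡πt′ =
    Σᶠ-zero λ s → trans (*-congˡ (glue-collapse (left (split s)) J π t≢t′ πt≡πt′)) (zeroʳ (u s))

  T-diagonal≉0 : ∀ u s σ σ⁻¹ → (∀ t → σ (σ⁻¹ t) ≡ t) → (∀ t → σ⁻¹ (σ t) ≡ t) →
                 u s ≉ 0# → T u (right (split s) ∘ permute₃ σ) ≉ 0#
  T-diagonal≉0 u s σ σ⁻¹ σ∘σ⁻¹≗id σ⁻¹∘σ≗id us≉0 T≈0 =
    x*y≉0 us≉0 (glue-diagonal≉0 s σ σ⁻¹ σ⁻¹∘σ≗id) (trans (sym (Σᶠ-single _ s off-diagonal)) T≈0)
    where
    off-diagonal : ∀ s′ → s′ ≢ s → u s′ * levi (glue (left (split s′)) (right (split s) ∘ permute₃ σ)) ≈ 0#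
    off-diagonal s′ s′≢s = trans (*-congˡ (glue-off-diagonal s′≢s σ σ⁻¹ σ∘σ⁻¹≗id)) (zeroʳ (u s′))

  -- On the indices right (split s) ∘ permute₃ π, T u is u s times a tensor with the support of det₃.
  T-rank>2 : ∀ u β γ → (∀ J → T u J ≈ elementary′ β J + elementary′ γ J) → ∀ s → ¬ u s ≉ 0#
  T-rank>2 u β γ rank-two s us≉0 = det₃-support-rank>2 (λ π → T u (J ∘ permute₃ π))
    (λ x → β 0F (J (x ↑ˡ m))) (λ y → β 1F (J (y ↑ˡ m))) (λ z → β 2F (J (z ↑ˡ m)) * rest β)
    (λ x → γ 0F (J (x ↑ˡ m))) (λ y → γ 1F (J (y ↑ˡ m))) (λ z → γ 2F (J (z ↑ˡ m)) * rest γ)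
    (λ π → rank-two (J ∘ permute₃ π))
    (T-collapse u J)
    (λ σ σ⁻¹ σ∘σ⁻¹≗id σ⁻¹∘σ≗id → T-diagonal≉0 u s σ σ⁻¹ σ∘σ⁻¹≗id σ⁻¹∘σ≗id us≉0)
    where
    J : Fin l → Fin n
    J = right (split s)
    rest : (Fin l → Vecᶠ n) → Carrier
    rest β = Πᶠ (λ b → β (suc (suc (suc b))) (J (suc (suc (suc b)))))

  unit : Fin (suc r) → Fin r → Carrier
  unit zero    _ = 0#
  unit (suc i) j with i Fin.≟ j
  ... | yes _ = 1#
  ... | no  _ = 0#

  unit-diagonal : ∀ i → unit (suc i) i ≈ 1#
  unit-diagonal i with i Fin.≟ i
  ... | yes _   = refl
  ... | no  i≢i = contradiction ≡.refl i≢i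

  unit-off-diagonal : ∀ {i j} → i ≢ j → unit (suc i) j ≈ 0#
  unit-off-diagonal {i} {j} i≢j with i Fin.≟ j
  ... | yes i≡j = contradiction i≡j i≢j
  ... | no  _   = refl

  unit-injective : ∀ {i i′} → (∀ j → unit i j ≈ unit i′ j) → i ≡ i′
  unit-injective {zero}  {zero}   _ = ≡.refl
  unit-injective {zero}  {suc i′} h = contradiction (trans (h i′) (unit-diagonal i′)) 0≉1
  unit-injective {suc i} {zero}   h = contradiction (trans (sym (h i)) (unit-diagonal i)) 0≉1
  unit-injective {suc i} {suc i′} h with i Fin.≟ i′
  ... | yes i≡i′ = cong suc i≡i′
  ... | no  i≢i′ =
    contradiction (trans (sym (unit-diagonal i)) (trans (h i) (unit-off-diagonal (i≢i′ ∘ ≡.sym)))) 1≉0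

  unitRow : Fin (suc r) → Fin l → Vecᶠ n
  unitRow zero    _ _ = 0#
  unitRow (suc i) b   = v i (k ↑ʳ b)

  Σᶠ-unit : ∀ i J → Σᶠ (λ j → unit i j * rightFactor j J) ≈ elementary′ (unitRow i) J
  Σᶠ-unit zero    J = trans (Σᶠ-zero λ j → zeroˡ (rightFactor j J)) (sym (zeroˡ _))
  Σᶠ-unit (suc i) J = begin
    Σᶠ (λ j → unit (suc i) j * rightFactor j J) ≈⟨ Σᶠ-single _ i off-diagonal ⟩
    unit (suc i) i * rightFactor i J            ≈⟨ *-congʳ (unit-diagonal i) ⟩
    1# * rightFactor i J                        ≈⟨ *-identityˡ _ ⟩
    rightFactor i J                             ∎
    where
    off-diagonal : ∀ j → j ≢ i → unit (suc i) j * rightFactor j J ≈ 0#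
    off-diagonal j j≢i = trans (*-congʳ (unit-off-diagonal (j≢i ∘ ≡.sym))) (zeroˡ _)

  meeting-translates : ∀ {i i′} u u′ → (∀ j → unit i j + L u j ≈ unit i′ j + L u′ j) →
                       ∀ s → ¬ (u s - u′ s) ≉ 0#
  meeting-translates {i} {i′} u u′ meeting = T-rank>2 d (unitRow i′) (negateFirst (unitRow i)) rank-two
    where
    d : Fin C → Carrier
    d s = u s - u′ s
    rank-two : ∀ J → T d J ≈ elementary′ (unitRow i′) J + elementary′ (negateFirst (unitRow i)) J
    rank-two J = begin
      T d J
        ≈⟨ T-expand d J ⟩
      Σᶠ (λ j → L d j * rightFactor j J)
        ≈⟨ Σᶠ-cong (λ j → *-congʳ (trans (Σᶠ-[x-y]*w u u′ _) (x+a≈y+b⇒a-b≈y-x (meeting j)))) ⟩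
      Σᶠ (λ j → (unit i′ j - unit i j) * rightFactor j J)
        ≈⟨ Σᶠ-[x-y]*w (unit i′) (unit i) _ ⟩
      Σᶠ (λ j → unit i′ j * rightFactor j J) - Σᶠ (λ j → unit i j * rightFactor j J)
        ≈⟨ +-cong (Σᶠ-unit i′ J) (-‿cong (Σᶠ-unit i J)) ⟩
      elementary′ (unitRow i′) J - elementary′ (unitRow i) J
        ≈⟨ +-congˡ (elementary′-negateFirst (unitRow i) J) ⟨
      elementary′ (unitRow i′) J + elementary′ (negateFirst (unitRow i)) J ∎

  module _ {q} (card : HasCardinality F q) where

    open Enumeration card

    translate : Fin (suc r) → (Fin C → Fin q) → Fin r → Carrier
    translate i w j = unit i j + L (enum ∘ w) j

    translate-injective : ∀ {i i′ w w′} → (∀ j → translate i w j ≈ translate i′ w′ j) → i ≡ i′ × w ≗ w′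
    translate-injective {i} {i′} {w} {w′} meeting = unit-injective unit≈unit , w≗w′
      where
      w≗w′ : w ≗ w′
      w≗w′ s = enum-injective (x∙y⁻¹≈ε⇒x≈y _ _
        (decidable-stable (_ ≟ _) (meeting-translates {i} {i′} (enum ∘ w) (enum ∘ w′) meeting s)))
      unit≈unit : ∀ j → unit i j ≈ unit i′ j
      unit≈unit j = +-cancelʳ (L (enum ∘ w) j) _ _ (trans (meeting j)
        (+-congˡ (Σᶠ-cong λ s → *-congʳ (reflexive (cong enum (≡.sym (w≗w′ s)))))))

    rank-bound : suc r ℕ.* q ^ C ≤ q ^ r
    rank-bound = ≗-injective⇒≤ (λ i w → index ∘ translate i w) (translate-injective ∘ (index-injective ∘_))

open Arithmetic using (⌊n/2⌋+3≤n; pascal; pascal≡C; exponent-gap)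

det-rank-bound : ∀ {c ℓ} (F : Field c ℓ) {q n r} → HasCardinality F q → 5 ≤ n →
                 TensorDefs.HasRankDecomp F (TensorDefs.det F n) r → suc r ℕ.* q ^ centralBinom n ≤ q ^ r
det-rank-bound F {q} {n} {r} card 5≤n decomposition with ℕ.m≤n⇒∃[o]m+o≡n (⌊n/2⌋+3≤n n 5≤n)
... | m , n/2+3+m≡n = ≡.subst (λ C → suc r ℕ.* q ^ C ≤ q ^ r) pascal≡centralBinom
                        (Flattening.rank-bound F (n / 2) m decomposition′ card)
  where
  n/2+[3+m]≡n : n / 2 ℕ.+ (3 ℕ.+ m) ≡ n
  n/2+[3+m]≡n = ≡.trans (≡.sym (ℕ.+-assoc (n / 2) 3 m)) n/2+3+m≡n

  decomposition′ : TensorDefs.HasRankDecomp F (TensorDefs.det F (n / 2 ℕ.+ (3 ℕ.+ m))) r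
  decomposition′ = ≡.subst (λ n′ → TensorDefs.HasRankDecomp F (TensorDefs.det F n′) r) (≡.sym n/2+[3+m]≡n)
                     decomposition

  pascal≡centralBinom : pascal (n / 2) (3 ℕ.+ m) ≡ centralBinom n
  pascal≡centralBinom = ≡.trans (pascal≡C (n / 2) (3 ℕ.+ m)) (cong (_C (n / 2)) n/2+[3+m]≡n)

theorem6p2 : ∀ {c ℓ} (F : Field c ℓ) (q n : ℕ) →
    IsPrimePower q → HasCardinality F q → 5 ≤ n →
    ∀ r → TensorDefs.HasRankDecomp F (TensorDefs.det F n) r →
    (centralBinom n ≤ r × suc r ≤ q ^ (r ∸ centralBinom n))
    × centralBinom n ≤ q ^ (r ∸ centralBinom n)
theorem6p2 F q n _ card 5≤n r decomposition
  with exponent-gap (FieldAlgebra.Enumeration.2≤q F card) (det-rank-bound F card 5≤n decomposition)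
... | C≤r , 1+r≤q^[r∸C] = (C≤r , 1+r≤q^[r∸C]) , ℕ.≤-trans C≤r (ℕ.≤-trans (ℕ.n≤1+n r) 1+r≤q^[r∸C])
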